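{- For every positive integer $n$, the Genocchi number $G_n$ is a multiple of the odd part of $n$ (the greatest odd positive divisor of $n$).
   Context: The Genocchi numbers $G_n$ ($n \geq 0$) are defined by $\frac{2t}{e^t+1} = \sum_{n=0}^{\infty} G_n \frac{t^n}{n!}$; they are all integers. -}

module Defs where

open import Data.Nat as ℕ using (ℕ; zero; suc; _∸_; _!; _≤_; NonZero)
open import Data.Nat.Properties using (_!≢0)
open import Data.Nat.Divisibility using (_∣_)
open import Data.Integer as ℤ using (ℤ; +_)
open import Data.Rational as ℚ using (ℚ; _+_; _*_; _-_; _÷_; _/_; 0ℚ; 1ℚ)
open import Data.List using (List; []; _∷_; _++_; [_]; foldr; zipWith; upTo)
open import Relation.Nullary using (¬_)

sumℚ : List ℚ → ℚ
sumℚ = foldr _+_ 0ℚ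

-- Formal power series over ℚ are represented by their coefficient functions ℕ → ℚ.

expSeries : ℕ → ℚ
expSeries n = (+ 1 / (n !)) {{n !≢0}}

expPlusOne : ℕ → ℚ
expPlusOne zero    = expSeries zero + 1ℚ
expPlusOne (suc n) = expSeries (suc n)

twoT : ℕ → ℚ
twoT (suc zero) = + 2 / 1
twoT _          = 0ℚ

-- Formal power series division num/den (den has nonzero constant term):
-- the unique q with q * den = num, computed coefficientwise from the Cauchy product:
-- q_n = (num_n - Σ_{k<n} q_k den_{n-k}) / den_0.
module SeriesDiv (num den : ℕ → ℚ) .{{_ : ℚ.NonZero (den 0)}} where
  next : List ℚ → ℕ → ℚ
  next prev n = (num n - sumℚ (zipWith (λ k a → a * den (n ∸ k)) (upTo n) prev)) ÷ den 0

  firstCoeffs : ℕ → List ℚ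
  firstCoeffs zero    = []
  firstCoeffs (suc n) = firstCoeffs n ++ [ next (firstCoeffs n) n ]

  coeff : ℕ → ℚ
  coeff n = next (firstCoeffs n) n

-- coefficients of 2t/(e^t+1) = Σ G_n t^n / n!
genocchiEGF : ℕ → ℚ
genocchiEGF = SeriesDiv.coeff twoT expPlusOne

G : ℕ → ℚ
G n = (+ (n !) / 1) * genocchiEGF n

Odd : ℕ → Set
Odd m = ¬ (2 ∣ m)

IsOddPart : ℕ → ℕ → Set
IsOddPart n m = Odd m × m ∣ n × (∀ d → Odd d → d ∣ n → d ≤ m)
  where open import Data.Product using (_×_)

-- Let aⱼ be the coefficients of A(t) = 2/(e^{2t}+1) = 1 − tanh t, i.e. aⱼ = 2ʲ G_{j+1}/(j+1).
-- Solving (e^{2t}+1) A = 2 for the leading coefficient shows that every aⱼ is an integer, and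
-- G_{j+1} = (j+1) aⱼ / 2ʲ.  An odd divisor m of j+1 divides 2ʲ G_{j+1} and hence G_{j+1}, once
-- we know 2ʲ ∣ (j+1) aⱼ.  This 2-adic bound is proved by strong induction: A(−t) = 2 − A(t) kills
-- aⱼ for even j ≥ 2, and for odd j the coefficient of t^{j+1} in e^{4t}A + e^{2t}A = 2e^{2t},
-- multiplied by j+2, gives 2ʲ ∣ (j+2)(j+1) aⱼ by induction, where j+2 is odd.
module Submission where

open import Defs
open import Data.Nat using (ℕ; _≥_)
open import Data.Integer using (ℤ; +_; _*_)
open import Data.Rational using (_/_)
open import Data.Product using (∃)
open import Relation.Binary.PropositionalEquality using (_≡_)

open import Algebra.Bundles using (AbelianGroup)
open import Data.Empty using (⊥-elim)
open import Data.Fin using (toℕ)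
open import Data.Fin.Properties using (toℕ<n; toℕ-inject₁; toℕ-fromℕ)
open import Data.Integer using (_+_; _-_; -_; _^_; ∣_∣; 0ℤ; 1ℤ; -1ℤ)
import Data.Integer.Coprimality as ℤC
open import Data.Integer.Divisibility.Signed
  using (_∣_; divides; quotient; ∣ᵤ⇒∣; ∣⇒∣ᵤ; ∣-trans; ∣m∣n⇒∣m+n; ∣m+n∣m⇒∣n; ∣n⇒∣m*n; ∣m⇒∣m*n;
         *-monoʳ-∣; *-cancelˡ-∣)
import Data.Integer.Properties as ℤP
open import Data.Integer.Solver using (module +-*-Solver)
open import Data.List using (_∷_; _∷ʳ_; zipWith; applyUpTo)
open import Data.List.Properties using (applyUpTo-∷ʳ)
open import Data.Nat as ℕ using (zero; suc; _∸_; _!; z<s; s<s)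
open import Data.Nat.Combinatorics
  using (_C_; nCn≡1; nC1≡n; k>n⇒nCk≡0; nCk≡nC[n∸k]; nCk+nC[k+1]≡[n+1]C[k+1]; nCk≡n!/k![n-k]!; k![n∸k]!∣n!)
import Data.Nat.Coprimality as ℕC
import Data.Nat.Divisibility as ℕD
open import Data.Nat.DivMod using (m/n*n≡m)
open import Data.Nat.Induction using (<-rec)
open import Data.Nat.Primality using (irreducible[2])
import Data.Nat.Properties as ℕP
import Data.Nat.Solver as ℕSolver
open import Data.Product using (_,_)
open import Data.Rational as ℚ using (ℚ; 0ℚ; toℚᵘ)
import Data.Rational.Properties as ℚP
open import Data.Rational.Unnormalised as ℚᵘ using (mkℚᵘ; *≡*) renaming (_≃_ to _≃ᵘ_)
import Data.Rational.Unnormalised.Properties as ℚᵘP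
open import Data.Sum using (inj₁; inj₂)
open import Function using (_∘_; id)
open import Relation.Binary.PropositionalEquality using (refl; sym; trans; cong; cong₂; subst; module ≡-Reasoning)
open import Relation.Nullary using (yes; no)

open import Algebra.Properties.Group (AbelianGroup.group ℤP.+-0-abelianGroup) using (∙-cancelˡ; inverseˡ-unique)
open import Algebra.Properties.Semiring.Sum ℤP.+-*-semiring
  using (sum; sum-cong-≗; sum-init-last; sum-replicate-zero; ∑-distrib-+; *-distribˡ-sum)
open +-*-Solver using (solve; _:+_; _:*_; _:-_; :-_; _:=_; con)
open ℕSolver.+-*-Solver using ()
  renaming (solve to solveℕ; _:+_ to _⊕_; _:*_ to _⊛_; _:=_ to _⊜_; con to conℕ)
open ≡-Reasoning

∑ : ℕ → (ℕ → ℤ) → ℤ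
∑ n f = sum {n} (f ∘ toℕ)

∑-cong : ∀ n {f g : ℕ → ℤ} → (∀ i → i ℕ.< n → f i ≡ g i) → ∑ n f ≡ ∑ n g
∑-cong n f≡g = sum-cong-≗ {n} (λ i → f≡g (toℕ i) (toℕ<n i))

∑-zero : ∀ n (f : ℕ → ℤ) → (∀ i → i ℕ.< n → f i ≡ 0ℤ) → ∑ n f ≡ 0ℤ
∑-zero n f f≡0 = trans (∑-cong n f≡0) (sum-replicate-zero n)

∑-last : ∀ n (f : ℕ → ℤ) → ∑ (suc n) f ≡ ∑ n f + f n
∑-last n f = trans (sum-init-last {n} (f ∘ toℕ))
  (cong₂ _+_ (sum-cong-≗ {n} (cong f ∘ toℕ-inject₁)) (cong f (toℕ-fromℕ n)))

∑-+ : ∀ n (f g : ℕ → ℤ) → ∑ n (λ i → f i + g i) ≡ ∑ n f + ∑ n g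
∑-+ n f g = ∑-distrib-+ {n} (f ∘ toℕ) (g ∘ toℕ)

*-distribˡ-∑ : ∀ n c (f : ℕ → ℤ) → c * ∑ n f ≡ ∑ n (λ i → c * f i)
*-distribˡ-∑ n c f = *-distribˡ-sum {n} c (f ∘ toℕ)

∣-∑ : ∀ {d} n (f : ℕ → ℤ) → (∀ i → i ℕ.< n → d ∣ f i) → d ∣ ∑ n f
∣-∑ {d} zero    f _   = divides 0ℤ (sym (ℤP.*-zeroˡ d))
∣-∑     (suc n) f d∣f = ∣m∣n⇒∣m+n (d∣f 0 z<s) (∣-∑ n (f ∘ suc) (λ i i<n → d∣f (suc i) (s<s i<n)))

[1+n]*nCk≡[1+k]*[1+n]C[1+k] : ∀ n k → suc n ℕ.* (n C k) ≡ suc k ℕ.* (suc n C suc k)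
[1+n]*nCk≡[1+k]*[1+n]C[1+k] zero    zero    = refl
[1+n]*nCk≡[1+k]*[1+n]C[1+k] zero    (suc k) = sym (ℕP.*-zeroʳ (suc (suc k)))
[1+n]*nCk≡[1+k]*[1+n]C[1+k] (suc n) zero    =
  trans (ℕP.*-identityʳ (suc (suc n))) (sym (trans (ℕP.+-identityʳ (suc (suc n) C 1)) (nC1≡n (suc (suc n)))))
[1+n]*nCk≡[1+k]*[1+n]C[1+k] (suc n) (suc k) = begin
  suc (suc n) ℕ.* (suc n C suc k)
    ≡⟨ cong (suc (suc n) ℕ.*_) (sym (nCk+nC[k+1]≡[n+1]C[k+1] n k)) ⟩
  suc (suc n) ℕ.* (x ℕ.+ y)
    ≡⟨ solveℕ 3 (λ n x y → (conℕ 2 ⊕ n) ⊛ (x ⊕ y) ⊜ ((conℕ 1 ⊕ n) ⊛ x ⊕ (conℕ 1 ⊕ n) ⊛ y) ⊕ (x ⊕ y)) refl n x y ⟩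
  (suc n ℕ.* x ℕ.+ suc n ℕ.* y) ℕ.+ (x ℕ.+ y)
    ≡⟨ cong₂ ℕ._+_ (cong₂ ℕ._+_ ([1+n]*nCk≡[1+k]*[1+n]C[1+k] n k) ([1+n]*nCk≡[1+k]*[1+n]C[1+k] n (suc k)))
                   (nCk+nC[k+1]≡[n+1]C[k+1] n k) ⟩
  (suc k ℕ.* X ℕ.+ suc (suc k) ℕ.* Y) ℕ.+ X
    ≡⟨ solveℕ 3 (λ k X Y → ((conℕ 1 ⊕ k) ⊛ X ⊕ (conℕ 2 ⊕ k) ⊛ Y) ⊕ X ⊜ (conℕ 2 ⊕ k) ⊛ (X ⊕ Y)) refl k X Y ⟩
  suc (suc k) ℕ.* (X ℕ.+ Y)
    ≡⟨ cong (suc (suc k) ℕ.*_) (nCk+nC[k+1]≡[n+1]C[k+1] (suc n) (suc k)) ⟩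
  suc (suc k) ℕ.* (suc (suc n) C suc (suc k)) ∎
  where
  x = n C k
  y = n C suc k
  X = suc n C suc k
  Y = suc n C suc (suc k)

[1+n]C[n]≡1+n : ∀ n → suc n C n ≡ suc n
[1+n]C[n]≡1+n n =
  trans (nCk≡nC[n∸k] (ℕP.n≤1+n n)) (trans (cong (suc n C_) (ℕP.m+n∸n≡m 1 n)) (nC1≡n (suc n)))

nCk*[k!*[n∸k]!]≡n! : ∀ {n k} → k ℕ.≤ n → (n C k) ℕ.* (k ! ℕ.* (n ∸ k) !) ≡ n !
nCk*[k!*[n∸k]!]≡n! {n} {k} k≤n = trans (cong (ℕ._* (k ! ℕ.* (n ∸ k) !)) (nCk≡n!/k![n-k]! k≤n))
  (m/n*n≡m {{k ℕP.!* (n ∸ k) !≢0}} (k![n∸k]!∣n! k≤n))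

pos-^ : ∀ m n → + (m ℕ.^ n) ≡ (+ m) ^ n
pos-^ m zero    = refl
pos-^ m (suc n) = trans (ℤP.pos-* m (m ℕ.^ n)) (cong (+ m *_) (pos-^ m n))

-1^n*-1^n≡1 : ∀ n → -1ℤ ^ n * -1ℤ ^ n ≡ 1ℤ
-1^n*-1^n≡1 zero    = refl
-1^n*-1^n≡1 (suc n) =
  trans (solve 1 (λ s → (con -1ℤ :* s) :* (con -1ℤ :* s) := s :* s) refl (-1ℤ ^ n)) (-1^n*-1^n≡1 n)

[-i]^n≡-1^n*i^n : ∀ i n → (- i) ^ n ≡ -1ℤ ^ n * i ^ n
[-i]^n≡-1^n*i^n i zero    = refl
[-i]^n≡-1^n*i^n i (suc n) = trans (cong ((- i) *_) ([-i]^n≡-1^n*i^n i n))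
  (solve 3 (λ i s p → (:- i) :* (s :* p) := (con -1ℤ :* s) :* (i :* p)) refl i (-1ℤ ^ n) (i ^ n))

-1^[n*2]≡1 : ∀ n → -1ℤ ^ (n ℕ.* 2) ≡ 1ℤ
-1^[n*2]≡1 n = trans (cong (-1ℤ ^_) (ℕP.*-comm n 2)) (trans (sym (ℤP.^-*-assoc -1ℤ 2 n)) (ℤP.^-zeroˡ n))

odd⇒coprime-2 : ∀ {q} → Odd q → ℕC.Coprime q 2
odd⇒coprime-2 odd (d∣q , d∣2) with irreducible[2] d∣2
... | inj₁ d≡1 = d≡1
... | inj₂ refl = ⊥-elim (odd d∣q)

coprime-^ : ∀ {m n} k → ℕC.Coprime m n → ℕC.Coprime m (n ℕ.^ k)
coprime-^ zero    _      (_ , d∣1)    = ℕD.∣1⇒≡1 d∣1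
coprime-^ {n = n} (suc k) coprime {d} (d∣m , d∣nnᵏ) =
  coprime-^ k coprime (d∣m , ℕC.coprime-divisor d⊥n d∣nnᵏ)
  where
  d⊥n : ℕC.Coprime d n
  d⊥n (e∣d , e∣n) = coprime (ℕD.∣-trans e∣d d∣m , e∣n)

odd⇒coprime-2^ : ∀ {q} → Odd q → ∀ k → ℤC.Coprime (+ q) ((+ 2) ^ k)
odd⇒coprime-2^ {q} odd k = subst (ℕC.Coprime q) (cong ∣_∣ (pos-^ 2 k)) (coprime-^ k (odd⇒coprime-2 odd))

coprime-divisor : ∀ i j k → ℤC.Coprime i j → i ∣ j * k → i ∣ k
coprime-divisor i j k i⊥j = ∣ᵤ⇒∣ ∘ ℤC.coprime-divisor i j k i⊥j ∘ ∣⇒∣ᵤ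

odd∣c*2^j⇒odd∣c : ∀ {q} j c → Odd q → + q ∣ c * (+ 2) ^ j → + q ∣ c
odd∣c*2^j⇒odd∣c j c odd =
  coprime-divisor _ ((+ 2) ^ j) c (odd⇒coprime-2^ odd j) ∘ subst (_ ∣_) (ℤP.*-comm c ((+ 2) ^ j))

-- A sequence x : ℕ → ℤ stands for the exponential generating function Σ xⱼ tʲ/j!;
-- expMul r x stands for e^{rt} times it.
expMulTerm : ℤ → (ℕ → ℤ) → ℕ → ℕ → ℤ
expMulTerm r x j i = + (j C i) * (r ^ (j ∸ i) * x i)

expMul : ℤ → (ℕ → ℤ) → ℕ → ℤ
expMul r x j = ∑ (suc j) (expMulTerm r x j)

expMul-last : ∀ r x j → expMul r x j ≡ ∑ j (expMulTerm r x j) + x j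
expMul-last r x j = begin
  expMul r x j                                          ≡⟨ ∑-last j (expMulTerm r x j) ⟩
  ∑ j (expMulTerm r x j) + + (j C j) * (r ^ (j ∸ j) * x j)
    ≡⟨ cong₂ (λ c e → ∑ j (expMulTerm r x j) + + c * (r ^ e * x j)) (nCn≡1 j) (ℕP.n∸n≡0 j) ⟩
  ∑ j (expMulTerm r x j) + 1ℤ * (1ℤ * x j)
    ≡⟨ cong (_+_ (∑ j (expMulTerm r x j))) (trans (ℤP.*-identityˡ _) (ℤP.*-identityˡ (x j))) ⟩
  ∑ j (expMulTerm r x j) + x j                          ∎

expMul-head : ∀ r x → expMul r x 0 ≡ x 0
expMul-head r x = trans (expMul-last r x 0) (ℤP.+-identityˡ (x 0))

expMul-cong : ∀ r {x y : ℕ → ℤ} → (∀ i → x i ≡ y i) → ∀ j → expMul r x j ≡ expMul r y j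
expMul-cong r x≡y j = ∑-cong (suc j) (λ i _ → cong (λ z → + (j C i) * (r ^ (j ∸ i) * z)) (x≡y i))

expMul-+ : ∀ r x y j → expMul r (λ i → x i + y i) j ≡ expMul r x j + expMul r y j
expMul-+ r x y j = trans
  (∑-cong (suc j) (λ i _ → solve 4 (λ c p u v → c :* (p :* (u :+ v)) := c :* (p :* u) :+ c :* (p :* v))
                                    refl (+ (j C i)) (r ^ (j ∸ i)) (x i) (y i)))
  (∑-+ (suc j) (expMulTerm r x j) (expMulTerm r y j))

expMul-* : ∀ r c x j → expMul r (λ i → c * x i) j ≡ c * expMul r x j
expMul-* r c x j = trans
  (∑-cong (suc j) (λ i _ → solve 4 (λ b p c u → b :* (p :* (c :* u)) := c :* (b :* (p :* u)))
                                    refl (+ (j C i)) (r ^ (j ∸ i)) c (x i)))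
  (sym (*-distribˡ-∑ (suc j) c (expMulTerm r x j)))

-- (e^{rt} X)′ = r e^{rt} X + e^{rt} X′; on coefficients this is Pascal's rule
expMul-suc : ∀ r x j → expMul r x (suc j) ≡ r * expMul r x j + expMul r (x ∘ suc) j
expMul-suc r x j = begin
  t₀ + ∑ (suc j) (expMulTerm r x (suc j) ∘ suc)
    ≡⟨ cong (_+_ t₀) (∑-cong (suc j) (λ i _ → pascal i)) ⟩
  t₀ + ∑ (suc j) (λ i → expMulTerm r (x ∘ suc) j i + u i)
    ≡⟨ cong (_+_ t₀) (∑-+ (suc j) (expMulTerm r (x ∘ suc) j) u) ⟩
  t₀ + (expMul r (x ∘ suc) j + ∑ (suc j) u)
    ≡⟨ cong (λ s → t₀ + (expMul r (x ∘ suc) j + s)) ∑u ⟩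
  t₀ + (expMul r (x ∘ suc) j + r * ∑ j (expMulTerm r x j ∘ suc))
    ≡⟨ solve 5 (λ r p y e s → con 1ℤ :* (r :* p :* y) :+ (e :+ r :* s) := r :* (con 1ℤ :* (p :* y) :+ s) :+ e)
             refl r (r ^ j) (x 0) (expMul r (x ∘ suc) j) (∑ j (expMulTerm r x j ∘ suc)) ⟩
  r * expMul r x j + expMul r (x ∘ suc) j ∎
  where
  t₀ = expMulTerm r x (suc j) 0
  u : ℕ → ℤ
  u i = + (j C suc i) * (r ^ (j ∸ i) * x (suc i))
  pascal : ∀ i → expMulTerm r x (suc j) (suc i) ≡ expMulTerm r (x ∘ suc) j i + u i
  pascal i = trans (cong (λ c → + c * (r ^ (j ∸ i) * x (suc i))) (sym (nCk+nC[k+1]≡[n+1]C[k+1] j i)))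
    (trans (cong (_* (r ^ (j ∸ i) * x (suc i))) (ℤP.pos-+ (j C i) (j C suc i)))
           (ℤP.*-distribʳ-+ (r ^ (j ∸ i) * x (suc i)) (+ (j C i)) (+ (j C suc i))))
  u≡r*term : ∀ i → i ℕ.< j → u i ≡ r * expMulTerm r x j (suc i)
  u≡r*term i i<j = begin
    + (j C suc i) * (r ^ (j ∸ i) * x (suc i))
      ≡⟨ cong (λ e → + (j C suc i) * (r ^ e * x (suc i))) (ℕP.+-∸-assoc 1 i<j) ⟩
    + (j C suc i) * (r * r ^ (j ∸ suc i) * x (suc i))
      ≡⟨ solve 4 (λ c r p y → c :* (r :* p :* y) := r :* (c :* (p :* y)))
               refl (+ (j C suc i)) r (r ^ (j ∸ suc i)) (x (suc i)) ⟩
    r * expMulTerm r x j (suc i) ∎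
  uⱼ≡0 : u j ≡ 0ℤ
  uⱼ≡0 = trans (cong (λ c → + c * (r ^ (j ∸ j) * x (suc j))) (k>n⇒nCk≡0 (ℕP.n<1+n j)))
               (ℤP.*-zeroˡ (r ^ (j ∸ j) * x (suc j)))
  ∑u : ∑ (suc j) u ≡ r * ∑ j (expMulTerm r x j ∘ suc)
  ∑u = begin
    ∑ (suc j) u           ≡⟨ ∑-last j u ⟩
    ∑ j u + u j           ≡⟨ cong₂ _+_ (∑-cong j u≡r*term) uⱼ≡0 ⟩
    ∑ j (λ i → r * expMulTerm r x j (suc i)) + 0ℤ ≡⟨ ℤP.+-identityʳ _ ⟩
    ∑ j (λ i → r * expMulTerm r x j (suc i))      ≡⟨ sym (*-distribˡ-∑ j r (expMulTerm r x j ∘ suc)) ⟩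
    r * ∑ j (expMulTerm r x j ∘ suc)              ∎

expMul-expMul : ∀ r s x j → expMul r (expMul s x) j ≡ expMul (r + s) x j
expMul-expMul r s x zero    = trans (expMul-head r (expMul s x)) (trans (expMul-head s x) (sym (expMul-head (r + s) x)))
expMul-expMul r s x (suc j) = begin
  expMul r (expMul s x) (suc j)                    ≡⟨ expMul-suc r (expMul s x) j ⟩
  r * E + expMul r (expMul s x ∘ suc) j            ≡⟨ cong (_+_ (r * E)) tail≡ ⟩
  r * E + (s * E + expMul r (expMul s (x ∘ suc)) j)
    ≡⟨ cong₂ (λ v w → r * v + (s * v + w)) (expMul-expMul r s x j) (expMul-expMul r s (x ∘ suc) j) ⟩
  r * V + (s * V + W)
    ≡⟨ solve 4 (λ r s v w → r :* v :+ (s :* v :+ w) := (r :+ s) :* v :+ w) refl r s V W ⟩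
  (r + s) * V + W                                  ≡⟨ sym (expMul-suc (r + s) x j) ⟩
  expMul (r + s) x (suc j)                         ∎
  where
  E = expMul r (expMul s x) j
  V = expMul (r + s) x j
  W = expMul (r + s) (x ∘ suc) j
  tail≡ : expMul r (expMul s x ∘ suc) j ≡ s * E + expMul r (expMul s (x ∘ suc)) j
  tail≡ = begin
    expMul r (expMul s x ∘ suc) j
      ≡⟨ expMul-cong r {expMul s x ∘ suc} {λ i → s * expMul s x i + expMul s (x ∘ suc) i} (expMul-suc s x) j ⟩
    expMul r (λ i → s * expMul s x i + expMul s (x ∘ suc) i) j
      ≡⟨ expMul-+ r (λ i → s * expMul s x i) (expMul s (x ∘ suc)) j ⟩
    expMul r (λ i → s * expMul s x i) j + expMul r (expMul s (x ∘ suc)) j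
      ≡⟨ cong (_+ expMul r (expMul s (x ∘ suc)) j) (expMul-* r s (expMul s x) j) ⟩
    s * E + expMul r (expMul s (x ∘ suc)) j ∎

expMul-identity : ∀ x j → expMul 0ℤ x j ≡ x j
expMul-identity x j = begin
  expMul 0ℤ x j                  ≡⟨ expMul-last 0ℤ x j ⟩
  ∑ j (expMulTerm 0ℤ x j) + x j  ≡⟨ cong (_+ x j) (∑-zero j (expMulTerm 0ℤ x j) term≡0) ⟩
  0ℤ + x j                       ≡⟨ ℤP.+-identityˡ (x j) ⟩
  x j                            ∎
  where
  term≡0 : ∀ i → i ℕ.< j → expMulTerm 0ℤ x j i ≡ 0ℤ
  term≡0 i i<j = trans (cong (λ e → + (j C i) * (0ℤ ^ e * x i)) (ℕP.+-∸-assoc 1 i<j))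
                       (ℤP.*-zeroʳ (+ (j C i)))

-- the series c, not the constant sequence
constant : ℤ → ℕ → ℤ
constant c zero    = c
constant c (suc _) = 0ℤ

expMul-constant : ∀ r c j → expMul r (constant c) j ≡ r ^ j * c
expMul-constant r c j = begin
  1ℤ * (r ^ j * c) + ∑ j (expMulTerm r (constant c) j ∘ suc)
    ≡⟨ cong₂ _+_ (ℤP.*-identityˡ (r ^ j * c)) (∑-zero j _ (λ i _ → term≡0 i)) ⟩
  r ^ j * c + 0ℤ   ≡⟨ ℤP.+-identityʳ (r ^ j * c) ⟩
  r ^ j * c        ∎
  where
  term≡0 : ∀ i → expMulTerm r (constant c) j (suc i) ≡ 0ℤ
  term≡0 i = trans (cong (+ (j C suc i) *_) (ℤP.*-zeroʳ (r ^ (j ∸ suc i)))) (ℤP.*-zeroʳ (+ (j C suc i)))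

-- X(−t)
alternate : (ℕ → ℤ) → ℕ → ℤ
alternate x i = -1ℤ ^ i * x i

expMul-alternate : ∀ r x j → expMul r (alternate x) j ≡ -1ℤ ^ j * expMul (- r) x j
expMul-alternate r x j = trans (∑-cong (suc j) (λ i i≤j → sym (term i (ℕ.s≤s⁻¹ i≤j))))
  (sym (*-distribˡ-∑ (suc j) (-1ℤ ^ j) (expMulTerm (- r) x j)))
  where
  term : ∀ i → i ℕ.≤ j → -1ℤ ^ j * expMulTerm (- r) x j i ≡ expMulTerm r (alternate x) j i
  term i i≤j = begin
    -1ℤ ^ j * (c * ((- r) ^ k * x i))
      ≡⟨ cong₂ (λ s p → s * (c * (p * x i)))
               (trans (cong (-1ℤ ^_) (sym (ℕP.m∸n+n≡m i≤j))) (ℤP.^-distribˡ-+-* -1ℤ k i))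
               ([-i]^n≡-1^n*i^n r k) ⟩
    -1ℤ ^ k * -1ℤ ^ i * (c * (-1ℤ ^ k * r ^ k * x i))
      ≡⟨ solve 5 (λ sₖ sᵢ c p y → sₖ :* sᵢ :* (c :* (sₖ :* p :* y)) := sₖ :* sₖ :* (c :* (p :* (sᵢ :* y))))
               refl (-1ℤ ^ k) (-1ℤ ^ i) c (r ^ k) (x i) ⟩
    -1ℤ ^ k * -1ℤ ^ k * (c * (r ^ k * alternate x i))
      ≡⟨ cong (_* (c * (r ^ k * alternate x i))) (-1^n*-1^n≡1 k) ⟩
    1ℤ * (c * (r ^ k * alternate x i))
      ≡⟨ ℤP.*-identityˡ _ ⟩
    c * (r ^ k * alternate x i) ∎
    where
    k = j ∸ i
    c = + (j C i)

-- the j-th coefficient of (e^{rt} + 1) X is 2 xⱼ plus terms in x₀ … x_{j−1}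
expMul+id-injective : ∀ r {y z : ℕ → ℤ} → (∀ j → expMul r y j + y j ≡ expMul r z j + z j) →
                      ∀ j → y j ≡ z j
expMul+id-injective r {y} {z} eq = <-rec (λ j → y j ≡ z j) step
  where
  step : ∀ j → (∀ {i} → i ℕ.< j → y i ≡ z i) → y j ≡ z j
  step j IH = ℤP.*-cancelˡ-≡ (+ 2) (y j) (z j) (∙-cancelˡ (∑ j (expMulTerm r y j)) _ _ (begin
    ∑ j (expMulTerm r y j) + + 2 * y j
      ≡⟨ solve 2 (λ s u → s :+ con (+ 2) :* u := s :+ u :+ u) refl (∑ j (expMulTerm r y j)) (y j) ⟩
    ∑ j (expMulTerm r y j) + y j + y j ≡⟨ cong (_+ y j) (sym (expMul-last r y j)) ⟩
    expMul r y j + y j ≡⟨ eq j ⟩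
    expMul r z j + z j ≡⟨ cong (_+ z j) (expMul-last r z j) ⟩
    ∑ j (expMulTerm r z j) + z j + z j ≡⟨ cong (λ s → s + z j + z j) (sym lower≡) ⟩
    ∑ j (expMulTerm r y j) + z j + z j
      ≡⟨ solve 2 (λ s u → s :+ u :+ u := s :+ con (+ 2) :* u) refl (∑ j (expMulTerm r y j)) (z j) ⟩
    ∑ j (expMulTerm r y j) + + 2 * z j ∎))
    where
    lower≡ : ∑ j (expMulTerm r y j) ≡ ∑ j (expMulTerm r z j)
    lower≡ = ∑-cong j (λ i i<j → cong (λ w → + (j C i) * (r ^ (j ∸ i) * w)) (IH i<j))

-- Coefficients of A(t) = 2/(e^{2t}+1) = 1 − tanh t, from (e^{2t}+1) A = 2 solved for the
-- leading coefficient; the first argument is fuel, sufficient when it exceeds the index.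
oneMinusTanhᶠ : ℕ → ℕ → ℤ
oneMinusTanhᶠ zero    _       = 0ℤ
oneMinusTanhᶠ (suc f) zero    = 1ℤ
oneMinusTanhᶠ (suc f) (suc j) =
  - ∑ (suc j) (λ i → + (suc j C i) * ((+ 2) ^ (j ∸ i) * oneMinusTanhᶠ f i))

oneMinusTanhᶠ-stable : ∀ f g j → j ℕ.< f → j ℕ.< g → oneMinusTanhᶠ f j ≡ oneMinusTanhᶠ g j
oneMinusTanhᶠ-stable (suc f) (suc g) zero    _         _         = refl
oneMinusTanhᶠ-stable (suc f) (suc g) (suc j) (s<s j<f) (s<s j<g) =
  cong -_ (∑-cong (suc j) (λ i i<1+j → cong (λ w → + (suc j C i) * ((+ 2) ^ (j ∸ i) * w))
    (oneMinusTanhᶠ-stable f g i (ℕP.<-≤-trans i<1+j j<f) (ℕP.<-≤-trans i<1+j j<g))))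

oneMinusTanh : ℕ → ℤ
oneMinusTanh j = oneMinusTanhᶠ (suc j) j

oneMinusTanh-suc : ∀ j →
  oneMinusTanh (suc j) ≡ - ∑ (suc j) (λ i → + (suc j C i) * ((+ 2) ^ (j ∸ i) * oneMinusTanh i))
oneMinusTanh-suc j = cong -_ (∑-cong (suc j) (λ i i<1+j → cong (λ w → + (suc j C i) * ((+ 2) ^ (j ∸ i) * w))
  (oneMinusTanhᶠ-stable (suc j) (suc i) i i<1+j (ℕP.n<1+n i))))

oneMinusTanh-spec : ∀ j → expMul (+ 2) oneMinusTanh j + oneMinusTanh j ≡ constant (+ 2) j
oneMinusTanh-spec zero    = refl
oneMinusTanh-spec (suc j) = begin
  expMul (+ 2) a (suc j) + a (suc j)             ≡⟨ cong (_+ a (suc j)) (expMul-last (+ 2) a (suc j)) ⟩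
  ∑ (suc j) (expMulTerm (+ 2) a (suc j)) + a (suc j) + a (suc j)
    ≡⟨ cong₂ (λ s t → s + t + t) (trans (∑-cong (suc j) (λ i i<1+j → halve i (ℕ.s≤s⁻¹ i<1+j)))
                                         (sym (*-distribˡ-∑ (suc j) (+ 2) h)))
                                  (oneMinusTanh-suc j) ⟩
  + 2 * ∑ (suc j) h + - ∑ (suc j) h + - ∑ (suc j) h
    ≡⟨ solve 1 (λ s → con (+ 2) :* s :+ :- s :+ :- s := con 0ℤ) refl (∑ (suc j) h) ⟩
  0ℤ                                             ∎
  where
  a = oneMinusTanh
  h : ℕ → ℤ
  h i = + (suc j C i) * ((+ 2) ^ (j ∸ i) * a i)
  halve : ∀ i → i ℕ.≤ j → expMulTerm (+ 2) a (suc j) i ≡ + 2 * h i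
  halve i i≤j = trans (cong (λ e → + (suc j C i) * ((+ 2) ^ e * a i)) (ℕP.+-∸-assoc 1 i≤j))
    (solve 3 (λ c p y → c :* (con (+ 2) :* p :* y) := con (+ 2) :* (c :* (p :* y)))
             refl (+ (suc j C i)) ((+ 2) ^ (j ∸ i)) (a i))

expMul-oneMinusTanh-spec : ∀ j →
  expMul (+ 2) (expMul (+ 2) oneMinusTanh) j + expMul (+ 2) oneMinusTanh j ≡ (+ 2) ^ j * + 2
expMul-oneMinusTanh-spec j = begin
  expMul (+ 2) (expMul (+ 2) oneMinusTanh) j + expMul (+ 2) oneMinusTanh j
    ≡⟨ sym (expMul-+ (+ 2) (expMul (+ 2) oneMinusTanh) oneMinusTanh j) ⟩
  expMul (+ 2) (λ i → expMul (+ 2) oneMinusTanh i + oneMinusTanh i) j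
    ≡⟨ expMul-cong (+ 2) oneMinusTanh-spec j ⟩
  expMul (+ 2) (constant (+ 2)) j
    ≡⟨ expMul-constant (+ 2) (+ 2) j ⟩
  (+ 2) ^ j * + 2 ∎

-- A(−t) (e^{2t}+1) = e^{2t} A(−t) (1 + e^{−2t}) = 2 e^{2t}
alternate-oneMinusTanh-spec : ∀ j →
  expMul (+ 2) (alternate oneMinusTanh) j + alternate oneMinusTanh j ≡ (+ 2) ^ j * + 2
alternate-oneMinusTanh-spec j = begin
  expMul (+ 2) (alternate a) j + alternate a j
    ≡⟨ cong (_+ alternate a j) (expMul-alternate (+ 2) a j) ⟩
  s * expMul -2ℤ a j + s * a j
    ≡⟨ sym (ℤP.*-distribˡ-+ s (expMul -2ℤ a j) (a j)) ⟩
  s * (expMul -2ℤ a j + a j)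
    ≡⟨ cong (λ z → s * (expMul -2ℤ a j + z)) (sym (trans (expMul-expMul -2ℤ (+ 2) a j) (expMul-identity a j))) ⟩
  s * (expMul -2ℤ a j + expMul -2ℤ (expMul (+ 2) a) j)
    ≡⟨ cong (s *_) (trans (ℤP.+-comm (expMul -2ℤ a j) (expMul -2ℤ (expMul (+ 2) a) j))
                          (sym (expMul-+ -2ℤ (expMul (+ 2) a) a j))) ⟩
  s * expMul -2ℤ (λ i → expMul (+ 2) a i + a i) j
    ≡⟨ cong (s *_) (trans (expMul-cong -2ℤ oneMinusTanh-spec j) (expMul-constant -2ℤ (+ 2) j)) ⟩
  s * (-2ℤ ^ j * + 2)
    ≡⟨ cong (λ p → s * (p * + 2)) ([-i]^n≡-1^n*i^n (+ 2) j) ⟩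
  s * (s * (+ 2) ^ j * + 2)
    ≡⟨ solve 2 (λ s p → s :* (s :* p :* con (+ 2)) := s :* s :* (p :* con (+ 2))) refl s ((+ 2) ^ j) ⟩
  s * s * ((+ 2) ^ j * + 2)
    ≡⟨ trans (cong (_* ((+ 2) ^ j * + 2)) (-1^n*-1^n≡1 j)) (ℤP.*-identityˡ _) ⟩
  (+ 2) ^ j * + 2 ∎
  where
  a = oneMinusTanh
  s = -1ℤ ^ j
  -2ℤ : ℤ
  -2ℤ = - (+ 2)

oneMinusTanh-reflect : ∀ j → alternate oneMinusTanh j ≡ expMul (+ 2) oneMinusTanh j
oneMinusTanh-reflect = expMul+id-injective (+ 2)
  (λ j → trans (alternate-oneMinusTanh-spec j) (sym (expMul-oneMinusTanh-spec j)))

oneMinusTanh-even : ∀ q → oneMinusTanh (suc q ℕ.* 2) ≡ 0ℤ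
oneMinusTanh-even q = ℤP.*-cancelˡ-≡ (+ 2) (a j) 0ℤ (begin
  + 2 * a j                 ≡⟨ solve 1 (λ x → con (+ 2) :* x := x :+ x) refl (a j) ⟩
  a j + a j                 ≡⟨ cong (_+_ (a j)) a≡-a ⟩
  a j + - a j               ≡⟨ ℤP.+-inverseʳ (a j) ⟩
  0ℤ                        ∎)
  where
  a = oneMinusTanh
  j = suc q ℕ.* 2
  a≡-a : a j ≡ - a j
  a≡-a = begin
    a j              ≡⟨ sym (trans (cong (_* a j) (-1^[n*2]≡1 (suc q))) (ℤP.*-identityˡ (a j))) ⟩
    alternate a j    ≡⟨ oneMinusTanh-reflect j ⟩
    expMul (+ 2) a j ≡⟨ inverseˡ-unique (expMul (+ 2) a j) (a j) (oneMinusTanh-spec j) ⟩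
    - a j            ∎

-- e^{4t} A + e^{2t} A = 2 e^{2t}, where e^{2t} A = 2 − A has no terms beyond the constant one
expMul4-oneMinusTanh : ∀ n → ∑ (suc n) (expMulTerm (+ 4) oneMinusTanh (suc n)) ≡ (+ 2) ^ suc n * + 2
expMul4-oneMinusTanh n = begin
  S                                      ≡⟨ sym (ℤP.+-identityʳ S) ⟩
  S + 0ℤ                                 ≡⟨ cong (_+_ S) (sym (oneMinusTanh-spec N)) ⟩
  S + (expMul (+ 2) a N + a N)
    ≡⟨ solve 3 (λ s e x → s :+ (e :+ x) := s :+ x :+ e) refl S (expMul (+ 2) a N) (a N) ⟩
  (S + a N) + expMul (+ 2) a N           ≡⟨ cong (_+ expMul (+ 2) a N) (sym (expMul-last (+ 4) a N)) ⟩
  expMul (+ 4) a N + expMul (+ 2) a N    ≡⟨ cong (_+ expMul (+ 2) a N) (sym (expMul-expMul (+ 2) (+ 2) a N)) ⟩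
  expMul (+ 2) (expMul (+ 2) a) N + expMul (+ 2) a N ≡⟨ expMul-oneMinusTanh-spec N ⟩
  (+ 2) ^ N * + 2                        ∎
  where
  a = oneMinusTanh
  N = suc n
  S = ∑ N (expMulTerm (+ 4) a N)

4^[2+e]*2^i : ∀ i e → (+ 4) ^ (2 ℕ.+ e) * (+ 2) ^ i ≡ (+ 2) ^ (2 ℕ.+ (suc i ℕ.+ e)) * (+ 2) ^ suc e
4^[2+e]*2^i i e = begin
  (+ 4) ^ (2 ℕ.+ e) * (+ 2) ^ i         ≡⟨ cong (_* (+ 2) ^ i) (ℤP.^-*-assoc (+ 2) 2 (2 ℕ.+ e)) ⟩
  (+ 2) ^ (2 ℕ.* (2 ℕ.+ e)) * (+ 2) ^ i ≡⟨ sym (ℤP.^-distribˡ-+-* (+ 2) (2 ℕ.* (2 ℕ.+ e)) i) ⟩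
  (+ 2) ^ (2 ℕ.* (2 ℕ.+ e) ℕ.+ i)
    ≡⟨ cong ((+ 2) ^_) (solveℕ 2 (λ i e → conℕ 2 ⊛ (conℕ 2 ⊕ e) ⊕ i ⊜ (conℕ 2 ⊕ (conℕ 1 ⊕ i ⊕ e)) ⊕ (conℕ 1 ⊕ e))
                               refl i e) ⟩
  (+ 2) ^ ((2 ℕ.+ (suc i ℕ.+ e)) ℕ.+ suc e) ≡⟨ ℤP.^-distribˡ-+-* (+ 2) (2 ℕ.+ (suc i ℕ.+ e)) (suc e) ⟩
  (+ 2) ^ (2 ℕ.+ (suc i ℕ.+ e)) * (+ 2) ^ suc e ∎

private
  [2+i+e]∸i≡2+e : ∀ i e → suc (suc (i ℕ.+ e)) ∸ i ≡ 2 ℕ.+ e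
  [2+i+e]∸i≡2+e i e = trans (cong (_∸ i) (sym (trans (ℕP.+-suc i (suc e)) (cong suc (ℕP.+-suc i e)))))
                            (ℕP.m+n∸m≡n i (2 ℕ.+ e))

-- (n+2) C(n+1,i) = (i+1) C(n+2,i+1) exposes the factor (i+1) aᵢ, and 2^{n+2} ∣ 4^{n+1−i} 2ⁱ when i < n
lowerTerm-divisible : ∀ i e → let n = suc i ℕ.+ e in (+ 2) ^ i ∣ + suc i * oneMinusTanh i →
  (+ 2) ^ (2 ℕ.+ n) ∣ + suc (suc n) * expMulTerm (+ 4) oneMinusTanh (suc n) i
lowerTerm-divisible i e 2ⁱ∣ = subst (2^[2+n] ∣_) (sym term≡)
  (∣n⇒∣m*n (+ (suc N C suc i)) (∣-trans 2^[2+n]∣F*2ⁱ (*-monoʳ-∣ F 2ⁱ∣)))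
  where
  n = suc i ℕ.+ e
  N = suc n
  F = (+ 4) ^ (2 ℕ.+ e)
  y = oneMinusTanh i
  2^[2+n] = (+ 2) ^ (2 ℕ.+ n)
  2^[2+n]∣F*2ⁱ : 2^[2+n] ∣ F * (+ 2) ^ i
  2^[2+n]∣F*2ⁱ = divides ((+ 2) ^ suc e) (trans (4^[2+e]*2^i i e) (ℤP.*-comm 2^[2+n] ((+ 2) ^ suc e)))
  term≡ : + suc N * expMulTerm (+ 4) oneMinusTanh N i ≡ + (suc N C suc i) * (F * (+ suc i * y))
  term≡ = begin
    + suc N * (+ (N C i) * ((+ 4) ^ (N ∸ i) * y))
      ≡⟨ cong (λ k → + suc N * (+ (N C i) * ((+ 4) ^ k * y))) ([2+i+e]∸i≡2+e i e) ⟩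
    + suc N * (+ (N C i) * (F * y))                ≡⟨ sym (ℤP.*-assoc (+ suc N) (+ (N C i)) (F * y)) ⟩
    + suc N * + (N C i) * (F * y)                  ≡⟨ cong (_* (F * y)) (sym (ℤP.pos-* (suc N) (N C i))) ⟩
    + (suc N ℕ.* (N C i)) * (F * y)                ≡⟨ cong (λ k → + k * (F * y)) ([1+n]*nCk≡[1+k]*[1+n]C[1+k] N i) ⟩
    + (suc i ℕ.* (suc N C suc i)) * (F * y)        ≡⟨ cong (_* (F * y)) (ℤP.pos-* (suc i) (suc N C suc i)) ⟩
    + suc i * + (suc N C suc i) * (F * y)
      ≡⟨ solve 4 (λ s c f y → s :* c :* (f :* y) := c :* (f :* (s :* y))) refl (+ suc i) (+ (suc N C suc i)) F y ⟩
    + (suc N C suc i) * (F * (+ suc i * y))        ∎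

2^n∣[2+n][1+n]oneMinusTanh : ∀ n → (∀ {i} → i ℕ.< n → (+ 2) ^ i ∣ + suc i * oneMinusTanh i) →
  (+ 2) ^ n ∣ + suc (suc n) * (+ suc n * oneMinusTanh n)
2^n∣[2+n][1+n]oneMinusTanh n IH = *-cancelˡ-∣ (+ 4) (subst (_∣ + 4 * X) 2^[2+n]≡4*2ⁿ 2^[2+n]∣4X)
  where
  a = oneMinusTanh
  N = suc n
  M = + suc N
  T = expMulTerm (+ 4) a N
  X = M * (+ N * a n)
  2^[2+n]≡4*2ⁿ : (+ 2) ^ (2 ℕ.+ n) ≡ + 4 * (+ 2) ^ n
  2^[2+n]≡4*2ⁿ = sym (ℤP.*-assoc (+ 2) (+ 2) ((+ 2) ^ n))
  lower∣ : ∀ i → i ℕ.< n → (+ 2) ^ (2 ℕ.+ n) ∣ M * T i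
  lower∣ i i<n with ℕP.m≤n⇒∃[o]m+o≡n i<n
  ... | e , refl = lowerTerm-divisible i e (IH i<n)
  lastTerm : M * T n ≡ + 4 * X
  lastTerm = begin
    M * (+ (N C n) * ((+ 4) ^ (N ∸ n) * a n))
      ≡⟨ cong₂ (λ c k → M * (+ c * ((+ 4) ^ k * a n))) ([1+n]C[n]≡1+n n) (ℕP.m+n∸n≡m 1 n) ⟩
    M * (+ N * ((+ 4) ^ 1 * a n))
      ≡⟨ solve 3 (λ m c y → m :* (c :* (con (+ 4) :* y)) := con (+ 4) :* (m :* (c :* y))) refl M (+ N) (a n) ⟩
    + 4 * X ∎
  total≡ : M * ((+ 2) ^ N * + 2) ≡ ∑ n (λ i → M * T i) + + 4 * X
  total≡ = begin
    M * ((+ 2) ^ N * + 2)           ≡⟨ cong (M *_) (sym (expMul4-oneMinusTanh n)) ⟩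
    M * ∑ N T                       ≡⟨ *-distribˡ-∑ N M T ⟩
    ∑ N (λ i → M * T i)             ≡⟨ ∑-last n (λ i → M * T i) ⟩
    ∑ n (λ i → M * T i) + M * T n   ≡⟨ cong (_+_ (∑ n (λ i → M * T i))) lastTerm ⟩
    ∑ n (λ i → M * T i) + + 4 * X   ∎
  2^[2+n]∣total : (+ 2) ^ (2 ℕ.+ n) ∣ M * ((+ 2) ^ N * + 2)
  2^[2+n]∣total = divides M (solve 2 (λ m p → m :* (con (+ 2) :* p :* con (+ 2)) := m :* (con (+ 2) :* (con (+ 2) :* p)))
                                   refl M ((+ 2) ^ n))
  2^[2+n]∣4X : (+ 2) ^ (2 ℕ.+ n) ∣ + 4 * X
  2^[2+n]∣4X = ∣m+n∣m⇒∣n (subst ((+ 2) ^ (2 ℕ.+ n) ∣_) total≡ 2^[2+n]∣total)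
                         (∣-∑ n (λ i → M * T i) lower∣)

2^n∣[1+n]oneMinusTanh : ∀ n → (+ 2) ^ n ∣ + suc n * oneMinusTanh n
2^n∣[1+n]oneMinusTanh = <-rec (λ n → (+ 2) ^ n ∣ + suc n * oneMinusTanh n) step
  where
  step : ∀ n → (∀ {i} → i ℕ.< n → (+ 2) ^ i ∣ + suc i * oneMinusTanh i) →
         (+ 2) ^ n ∣ + suc n * oneMinusTanh n
  step n IH with 2 ℕD.∣? n
  ... | yes (ℕD.divides zero    refl) = divides (+ 1 * oneMinusTanh 0) refl
  ... | yes (ℕD.divides (suc q) refl) =
    divides 0ℤ (trans (cong (+ suc (suc q ℕ.* 2) *_) (oneMinusTanh-even q)) (ℤP.*-zeroʳ (+ suc (suc q ℕ.* 2))))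
  ... | no 2∤n = coprime-divisor ((+ 2) ^ n) (+ suc (suc n)) (+ suc n * oneMinusTanh n)
                   (ℤC.sym {+ suc (suc n)} {(+ 2) ^ n} (odd⇒coprime-2^ 2∤2+n n))
                   (2^n∣[2+n][1+n]oneMinusTanh n IH)
    where
    2∤2+n : Odd (suc (suc n))
    2∤2+n 2∣2+n = 2∤n (ℕD.∣m+n∣m⇒∣n 2∣2+n ℕD.∣-refl)

toℚᵘ-/ : ∀ i n .{{_ : ℕ.NonZero n}} → toℚᵘ (i / n) ≃ᵘ (i ℚᵘ./ n)
toℚᵘ-/ i (suc n) = ℚP.toℚᵘ-fromℚᵘ (mkℚᵘ i n)

/-cross : ∀ i j n m .{{_ : ℕ.NonZero n}} .{{_ : ℕ.NonZero m}} → i * + m ≡ j * + n → i / n ≡ j / m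
/-cross i j (suc n) (suc m) eq = ℚP.fromℚᵘ-cong {mkℚᵘ i n} {mkℚᵘ j m} (*≡* eq)

/-* : ∀ i j n m .{{_ : ℕ.NonZero n}} .{{_ : ℕ.NonZero m}} .{{_ : ℕ.NonZero (n ℕ.* m)}} →
      (i / n) ℚ.* (j / m) ≡ (i * j) / (n ℕ.* m)
/-* i j (suc n) (suc m) = ℚP.toℚᵘ-injective (ℚᵘP.≃-trans (ℚP.toℚᵘ-homo-* (i / suc n) (j / suc m))
  (ℚᵘP.≃-trans (ℚᵘP.*-cong (toℚᵘ-/ i (suc n)) (toℚᵘ-/ j (suc m))) (ℚᵘP.≃-sym (toℚᵘ-/ (i * j) (suc n ℕ.* suc m)))))

/-+ : ∀ i j n .{{_ : ℕ.NonZero n}} → (i / n) ℚ.+ (j / n) ≡ (i + j) / n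
/-+ i j (suc n) = ℚP.toℚᵘ-injective (ℚᵘP.≃-trans (ℚP.toℚᵘ-homo-+ (i / suc n) (j / suc n))
  (ℚᵘP.≃-trans (ℚᵘP.+-cong (toℚᵘ-/ i (suc n)) (toℚᵘ-/ j (suc n)))
  (ℚᵘP.≃-trans (*≡* eq) (ℚᵘP.≃-sym (toℚᵘ-/ (i + j) (suc n))))))
  where
  eq : (i * + suc n + j * + suc n) * + suc n ≡ (i + j) * (+ suc n * + suc n)
  eq = solve 3 (λ i j d → (i :* d :+ j :* d) :* d := (i :+ j) :* (d :* d)) refl i j (+ suc n)

/-- : ∀ i j n .{{_ : ℕ.NonZero n}} → (i / n) ℚ.- (j / n) ≡ (i - j) / n
/-- i j n@(suc _) = trans (cong ((i / n) ℚ.+_) neg) (/-+ i (- j) n)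
  where
  neg : ℚ.- (j / n) ≡ (- j) / n
  neg = ℚP.toℚᵘ-injective (ℚᵘP.≃-trans (ℚP.toℚᵘ-homo‿- (j / n))
          (ℚᵘP.≃-trans (ℚᵘP.-‿cong (toℚᵘ-/ j n)) (ℚᵘP.≃-sym (toℚᵘ-/ (- j) n))))

scale : ℕ → ℕ
scale j = 2 ℕ.^ j ℕ.* j !

scale≢0 : ∀ j → ℕ.NonZero (scale j)
scale≢0 j = ℕP.m*n≢0 (2 ℕ.^ j) (j !) {{ℕP.m^n≢0 2 j}} {{j ℕP.!≢0}}

_/scale_ : ℤ → ℕ → ℚ
x /scale j = (x / scale j) {{scale≢0 j}}

scale-+ : ∀ i e → scale (i ℕ.+ e) ≡ ((i ℕ.+ e) C i) ℕ.* 2 ℕ.^ e ℕ.* (scale i ℕ.* e !)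
scale-+ i e = begin
  2 ℕ.^ (i ℕ.+ e) ℕ.* (i ℕ.+ e) !
    ≡⟨ cong₂ ℕ._*_ (ℕP.^-distribˡ-+-* 2 i e) (sym c*i!*e!≡[i+e]!) ⟩
  2 ℕ.^ i ℕ.* 2 ℕ.^ e ℕ.* (c ℕ.* (i ! ℕ.* e !))
    ≡⟨ solveℕ 5 (λ p q c f g → p ⊛ q ⊛ (c ⊛ (f ⊛ g)) ⊜ c ⊛ q ⊛ (p ⊛ f ⊛ g))
       refl (2 ℕ.^ i) (2 ℕ.^ e) c (i !) (e !) ⟩
  c ℕ.* 2 ℕ.^ e ℕ.* (scale i ℕ.* e !) ∎
  where
  c = (i ℕ.+ e) C i
  c*i!*e!≡[i+e]! : c ℕ.* (i ! ℕ.* e !) ≡ (i ℕ.+ e) !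
  c*i!*e!≡[i+e]! = subst (λ d → c ℕ.* (i ! ℕ.* d !) ≡ (i ℕ.+ e) !) (ℕP.m+n∸m≡n i e)
                         (nCk*[k!*[n∸k]!]≡n! (ℕP.m≤m+n i e))

/scale-*-expSeries : ∀ x i e →
  (x /scale i) ℚ.* expSeries e ≡ (+ ((i ℕ.+ e) C i) * ((+ 2) ^ e * x)) /scale (i ℕ.+ e)
/scale-*-expSeries x i e =
  trans (/-* x (+ 1) (scale i) (e !)) (/-cross (x * + 1) y (scale i ℕ.* e !) (scale (i ℕ.+ e)) cross)
  where
  instance
    _ = scale≢0 i
    _ = scale≢0 (i ℕ.+ e)
    _ = e ℕP.!≢0
    _ = ℕP.m*n≢0 (scale i) (e !)
  c = (i ℕ.+ e) C i
  y = + c * ((+ 2) ^ e * x)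
  cross : x * + 1 * + scale (i ℕ.+ e) ≡ y * + (scale i ℕ.* e !)
  cross = begin
    x * + 1 * + scale (i ℕ.+ e)                        ≡⟨ cong (λ d → x * + 1 * + d) (scale-+ i e) ⟩
    x * + 1 * + (c ℕ.* 2 ℕ.^ e ℕ.* (scale i ℕ.* e !))
      ≡⟨ cong (x * + 1 *_) (trans (ℤP.pos-* (c ℕ.* 2 ℕ.^ e) (scale i ℕ.* e !))
                                  (cong (_* + (scale i ℕ.* e !)) (trans (ℤP.pos-* c (2 ℕ.^ e)) (cong (+ c *_) (pos-^ 2 e))))) ⟩
    x * + 1 * (+ c * (+ 2) ^ e * + (scale i ℕ.* e !))
      ≡⟨ solve 4 (λ x c p d → x :* con (+ 1) :* (c :* p :* d) := c :* (p :* x) :* d)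
         refl x (+ c) ((+ 2) ^ e) (+ (scale i ℕ.* e !)) ⟩
    y * + (scale i ℕ.* e !)                            ∎

open SeriesDiv twoT expPlusOne using (firstCoeffs; coeff)

firstCoeffs≡applyUpTo : ∀ n → firstCoeffs n ≡ applyUpTo coeff n
firstCoeffs≡applyUpTo zero    = refl
firstCoeffs≡applyUpTo (suc n) = trans (cong (_∷ʳ coeff n) (firstCoeffs≡applyUpTo n)) (applyUpTo-∷ʳ coeff n)

zipWith-applyUpTo : ∀ {A B C : Set} (f : A → B → C) g h n →
  zipWith f (applyUpTo g n) (applyUpTo h n) ≡ applyUpTo (λ k → f (g k) (h k)) n
zipWith-applyUpTo f g h zero    = refl
zipWith-applyUpTo f g h (suc n) = cong (f (g 0) (h 0) ∷_) (zipWith-applyUpTo f (g ∘ suc) (h ∘ suc) n)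

applyUpTo-cong : ∀ {A : Set} n {f g : ℕ → A} → (∀ i → i ℕ.< n → f i ≡ g i) →
                 applyUpTo f n ≡ applyUpTo g n
applyUpTo-cong zero    _   = refl
applyUpTo-cong (suc n) f≡g = cong₂ _∷_ (f≡g 0 z<s) (applyUpTo-cong n (λ i i<n → f≡g (suc i) (s<s i<n)))

sumℚ-/ : ∀ n (t : ℕ → ℤ) d .{{_ : ℕ.NonZero d}} → sumℚ (applyUpTo (λ i → t i / d) n) ≡ ∑ n t / d
sumℚ-/ zero    t d = sym (ℚP.0/n≡0 d)
sumℚ-/ (suc n) t d = trans (cong (t 0 / d ℚ.+_) (sumℚ-/ n (t ∘ suc) d)) (/-+ (t 0) (∑ n (t ∘ suc)) d)

coeff-rec : ∀ n →
  coeff n ≡ (twoT n ℚ.- sumℚ (applyUpTo (λ k → coeff k ℚ.* expPlusOne (n ∸ k)) n)) ℚ.÷ expPlusOne 0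
coeff-rec n = cong (λ l → (twoT n ℚ.- sumℚ l) ℚ.÷ expPlusOne 0)
  (trans (cong (zipWith (λ k a → a ℚ.* expPlusOne (n ∸ k)) (applyUpTo id n)) (firstCoeffs≡applyUpTo n))
         (zipWith-applyUpTo (λ k a → a ℚ.* expPlusOne (n ∸ k)) id coeff n))

twoT-suc : ∀ j → twoT (suc j) ≡ constant (+ 2) j /scale j
twoT-suc zero    = refl
twoT-suc (suc j) = sym (ℚP.0/n≡0 (scale (suc j)) {{scale≢0 (suc j)}})

genocchiEGF-suc : ∀ j → genocchiEGF (suc j) ≡ oneMinusTanh j /scale j
genocchiEGF-suc = <-rec (λ j → coeff (suc j) ≡ oneMinusTanh j /scale j) step
  where
  step : ∀ j → (∀ {i} → i ℕ.< j → coeff (suc i) ≡ oneMinusTanh i /scale i) →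
         coeff (suc j) ≡ oneMinusTanh j /scale j
  step j IH = begin
    coeff (suc j)
      ≡⟨ coeff-rec (suc j) ⟩
    (twoT (suc j) ℚ.- (F 0 ℚ.+ sumℚ (applyUpTo (F ∘ suc) j))) ℚ.÷ expPlusOne 0
      ≡⟨ cong₂ (λ u v → (u ℚ.- v) ℚ.÷ expPlusOne 0) (twoT-suc j)
               (cong₂ ℚ._+_ (ℚP.*-zeroˡ (expPlusOne (suc j)))
                            (trans (cong sumℚ (applyUpTo-cong j F[1+i])) (sumℚ-/ j t (scale j)))) ⟩
    (c /scale j ℚ.- (0ℚ ℚ.+ ∑ j t /scale j)) ℚ.÷ expPlusOne 0
      ≡⟨ cong (λ u → (c /scale j ℚ.- u) ℚ.÷ expPlusOne 0) (ℚP.+-identityˡ (∑ j t /scale j)) ⟩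
    (c /scale j ℚ.- ∑ j t /scale j) ℚ.* (+ 1 / 2)
      ≡⟨ cong (ℚ._* (+ 1 / 2)) (/-- c (∑ j t) (scale j)) ⟩
    ((c - ∑ j t) /scale j) ℚ.* (+ 1 / 2)
      ≡⟨ /-* (c - ∑ j t) (+ 1) (scale j) 2 ⟩
    (c - ∑ j t) * + 1 / (scale j ℕ.* 2)
      ≡⟨ /-cross ((c - ∑ j t) * + 1) (a j) (scale j ℕ.* 2) (scale j) cross ⟩
    a j /scale j ∎
    where
    instance
      _ = scale≢0 j
      _ = ℕP.m*n≢0 (scale j) 2
    a = oneMinusTanh
    c = constant (+ 2) j
    t = expMulTerm (+ 2) a j
    F : ℕ → ℚ
    F k = coeff k ℚ.* expPlusOne (suc j ∸ k)
    F[1+i] : ∀ i → i ℕ.< j → F (suc i) ≡ t i /scale j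
    F[1+i] i i<j = begin
      coeff (suc i) ℚ.* expPlusOne (j ∸ i)
        ≡⟨ cong₂ ℚ._*_ (IH i<j) (trans (cong expPlusOne j∸i≡1+e) (cong expSeries (sym j∸i≡1+e))) ⟩
      (a i /scale i) ℚ.* expSeries (j ∸ i)
        ≡⟨ /scale-*-expSeries (a i) i (j ∸ i) ⟩
      (+ ((i ℕ.+ (j ∸ i)) C i) * ((+ 2) ^ (j ∸ i) * a i)) /scale (i ℕ.+ (j ∸ i))
        ≡⟨ cong (λ n → (+ (n C i) * ((+ 2) ^ (j ∸ i) * a i)) /scale n) (ℕP.m+[n∸m]≡n (ℕP.<⇒≤ i<j)) ⟩
      t i /scale j ∎
      where
      j∸i≡1+e : j ∸ i ≡ suc (j ∸ suc i)
      j∸i≡1+e = ℕP.+-∸-assoc 1 i<j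
    cross : (c - ∑ j t) * + 1 * + scale j ≡ a j * + (scale j ℕ.* 2)
    cross = begin
      (c - ∑ j t) * + 1 * + scale j
        ≡⟨ cong (λ z → (z - ∑ j t) * + 1 * + scale j)
                (sym (trans (cong (_+ a j) (sym (expMul-last (+ 2) a j))) (oneMinusTanh-spec j))) ⟩
      (∑ j t + a j + a j - ∑ j t) * + 1 * + scale j
        ≡⟨ solve 3 (λ s x d → (s :+ x :+ x :- s) :* con (+ 1) :* d := x :* (d :* con (+ 2)))
           refl (∑ j t) (a j) (+ scale j) ⟩
      a j * (+ scale j * + 2)
        ≡⟨ cong (a j *_) (sym (ℤP.pos-* (scale j) 2)) ⟩
      a j * + (scale j ℕ.* 2) ∎

G-suc : ∀ j → G (suc j) ≡ (+ suc j * oneMinusTanh j / 2 ℕ.^ j) {{ℕP.m^n≢0 2 j}}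
G-suc j = begin
  (+ (suc j !) / 1) ℚ.* genocchiEGF (suc j)  ≡⟨ cong ((+ (suc j !) / 1) ℚ.*_) (genocchiEGF-suc j) ⟩
  (+ (suc j !) / 1) ℚ.* (a j /scale j)      ≡⟨ /-* (+ (suc j !)) (a j) 1 (scale j) ⟩
  + (suc j !) * a j / (1 ℕ.* scale j)       ≡⟨ /-cross (+ (suc j !) * a j) (+ suc j * a j) (1 ℕ.* scale j) (2 ℕ.^ j) cross ⟩
  + suc j * a j / 2 ℕ.^ j                   ∎
  where
  instance
    _ = scale≢0 j
    _ = ℕP.m*n≢0 1 (scale j)
    _ = ℕP.m^n≢0 2 j
  a = oneMinusTanh
  cross : + (suc j !) * a j * + (2 ℕ.^ j) ≡ + suc j * a j * + (1 ℕ.* scale j)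
  cross = begin
    + (suc j !) * a j * + (2 ℕ.^ j)           ≡⟨ cong (λ f → f * a j * + (2 ℕ.^ j)) (ℤP.pos-* (suc j) (j !)) ⟩
    + suc j * + (j !) * a j * + (2 ℕ.^ j)
      ≡⟨ solve 4 (λ s f x p → s :* f :* x :* p := s :* x :* (p :* f))
         refl (+ suc j) (+ (j !)) (a j) (+ (2 ℕ.^ j)) ⟩
    + suc j * a j * (+ (2 ℕ.^ j) * + (j !))
      ≡⟨ cong (+ suc j * a j *_) (sym (trans (cong +_ (ℕP.*-identityˡ (scale j))) (ℤP.pos-* (2 ℕ.^ j) (j !)))) ⟩
    + suc j * a j * + (1 ℕ.* scale j)          ∎

corollary2p2 : (n m : ℕ) → n ≥ 1 → IsOddPart n m →
    ∃ λ (k : ℤ) → G n ≡ (k * + m) / 1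
corollary2p2 (suc j) m _ (odd , m∣1+j , _) = k , (begin
  G (suc j)                ≡⟨ G-suc j ⟩
  + suc j * a j / 2 ℕ.^ j  ≡⟨ /-cross (+ suc j * a j) (k * + m) (2 ℕ.^ j) 1 cross ⟩
  (k * + m) / 1            ∎)
  where
  instance
    _ = ℕP.m^n≢0 2 j
  a = oneMinusTanh
  c : ℤ
  c = quotient (2^n∣[1+n]oneMinusTanh j)
  [1+j]a≡c*2ʲ : + suc j * a j ≡ c * (+ 2) ^ j
  [1+j]a≡c*2ʲ = _∣_.equality (2^n∣[1+n]oneMinusTanh j)
  m∣c : + m ∣ c
  m∣c = odd∣c*2^j⇒odd∣c j c odd
          (subst (+ m ∣_) [1+j]a≡c*2ʲ (∣m⇒∣m*n {+ m} {+ suc j} (a j) (∣ᵤ⇒∣ m∣1+j)))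
  k : ℤ
  k = quotient m∣c
  cross : + suc j * a j * + 1 ≡ k * + m * + (2 ℕ.^ j)
  cross = begin
    + suc j * a j * + 1    ≡⟨ ℤP.*-identityʳ (+ suc j * a j) ⟩
    + suc j * a j          ≡⟨ [1+j]a≡c*2ʲ ⟩
    c * (+ 2) ^ j          ≡⟨ cong₂ _*_ (_∣_.equality m∣c) (sym (pos-^ 2 j)) ⟩
    k * + m * + (2 ℕ.^ j)  ∎
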